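{- For all $(n,p)\in\mathbb{N}^2$, $$Sr(n,p)=\sum_{m=1}^{n}\min\{pm,\ n+1-m\},$$ and moreover $$Sr(n,p)=\begin{cases}1 & \text{if } n=1,\\ \binom{n+1}{2} & \text{if } p>n\ge 2,\\ \frac{1}{2}\left(p(\Delta+1)\Delta+(n-\Delta+1)(n-\Delta)\right) & \text{if } p\le n,\end{cases}$$ where $\Delta=\lfloor (n+1)/(p+1)\rfloor$.
   Context: $\mathbb{N}=\{1,2,3,\dots\}$ and $[n]=\{1,2,\dots,n\}$. For $(n,p)\in\mathbb{N}^2$, define $$Sr(n,p)=\left|\{F\subset[n] : F\neq\emptyset,\ p\min F\ge |F| \text{ and } F \text{ is an interval (a set of consecutive integers)}\}\right|,$$ where $|F|$ denotes the cardinality of $F$. -}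

module Defs where

open import Data.Bool using (Bool; true; false; T)
open import Data.Nat using (ℕ; zero; suc; _+_; _*_; _≤_; _<_; _≤?_)
open import Data.Nat.Properties using (_<?_)
open import Data.Fin using (Fin; toℕ)
open import Data.Fin.Properties using (all?)
open import Data.Fin.Subset using (Subset; Nonempty; ∣_∣; _∈_)
open import Data.Fin.Subset.Properties using (_∈?_; nonempty?)
open import Data.List using (List; []; _∷_; map; _++_; filter; length)
open import Data.Vec using (_∷_; [])
open import Data.Product using (_×_)
open import Relation.Nullary using (Dec; _→-dec_; _×-dec_)
open import Relation.Nullary.Decidable using (_×-dec_; _→-dec_)

-- Convention: Subset n = Vec Bool n represents a subset of [n] = {1,…,n};
-- index i : Fin n stands for the integer toℕ i + 1.

allSubsets : (n : ℕ) → List (Subset n)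
allSubsets zero = [] ∷ []
allSubsets (suc n) = map (true ∷_) (allSubsets n) ++ map (false ∷_) (allSubsets n)

-- min F as an element of [n] (1-based); value 0 for the empty set (never used)
minF : {n : ℕ} → Subset n → ℕ
minF [] = 0
minF (true ∷ F) = 1
minF (false ∷ F) with minF F
... | zero = 0
... | suc m = suc (suc m)

IsInterval : {n : ℕ} → Subset n → Set
IsInterval {n} F = (i j k : Fin n) → i ∈ F → k ∈ F → toℕ i ≤ toℕ j → toℕ j ≤ toℕ k → j ∈ F

isInterval? : {n : ℕ} (F : Subset n) → Dec (IsInterval F)
isInterval? F =
  all? λ i → all? λ j → all? λ k →
    (i ∈? F) →-dec ((k ∈? F) →-dec ((toℕ i ≤? toℕ j) →-dec ((toℕ j ≤? toℕ k) →-dec (j ∈? F))))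

SrCond : (n p : ℕ) → Subset n → Set
SrCond n p F = Nonempty F × (∣ F ∣ ≤ p * minF F) × IsInterval F

srCond? : (n p : ℕ) (F : Subset n) → Dec (SrCond n p F)
srCond? n p F = nonempty? F ×-dec ((∣ F ∣ ≤? p * minF F) ×-dec isInterval? F)

Sr : ℕ → ℕ → ℕ
Sr n p = length (filter (srCond? n p) (allSubsets n))

sumFrom1 : ℕ → (ℕ → ℕ) → ℕ
sumFrom1 zero f = 0
sumFrom1 (suc n) f = sumFrom1 n f + f (suc n)

{-# OPTIONS --safe #-}
-- Read a subset of [n] as one of {s+1, …, s+n} and peel off the first point s+1. The admissible
-- intervals through it are the initial segments of length at most p(s+1), of which there are
-- min(p(s+1), n); the remaining ones are the admissible intervals of {s+2, …, s+n}. Unrolling this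
-- recursion from s = 0 gives Sr(n,p) = Σ_m min(pm, n+1-m). Since (p+1)m ≤ n+1 exactly when m ≤ Δ,
-- the minimum is pm up to Δ and n+1-m afterwards, so the sum splits into two arithmetic series;
-- for p > n we have Δ = 0 and only the second one, (n+1)n/2, remains.
module Submission where

open import Defs
open import Data.Fin using (Fin; zero; suc; toℕ)
open import Data.Fin.Properties using (all?)
open import Data.Fin.Subset using (Subset; Nonempty; Empty; ∣_∣; _∈_; inside; outside)
open import Data.Fin.Subset.Properties using (_∈?_; nonempty?; drop-∷-Empty; Empty-unique; ∣⊥∣≡0)
open import Data.List using (List; []; _∷_; _++_; map; filter; length)
open import Data.List.Properties using (length-++; filter-++; filter-≐; filter-none)
open import Data.List.Relation.Unary.All using (universal)
open import Data.Nat
  using (ℕ; zero; suc; _+_; _*_; _∸_; _≤_; _<_; _⊓_; _/_; z≤n; s≤s; s≤s⁻¹; _≤?_; _<?_; NonZero)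
open import Data.Nat.Properties
open import Data.Nat.DivMod using (m/n*n≤m; m*n/n≡m; /-monoˡ-≤; m/n<m; m<n⇒m/n≡0)
open import Data.Nat.Combinatorics using (_C_; nCk+nC[k+1]≡[n+1]C[k+1]; nC1≡n)
open import Data.Nat.Tactic.RingSolver using (solve-∀)
open import Data.Product using (_×_; _,_; ∃)
open import Data.Vec using (_∷_; here; there)
open import Function using (_∘_; _⇔_; mk⇔; Equivalence)
open import Level using (0ℓ)
open import Relation.Nullary using (yes; no; ¬_; ¬?; _×-dec_; _→-dec_)
open import Relation.Unary using (Pred; Decidable; _≐_)
open import Relation.Binary.PropositionalEquality

private variable
  A B : Set
  n : ℕ

length-filter-map : {P : Pred B 0ℓ} (P? : Decidable P) (f : A → B) (xs : List A) →
                    length (filter P? (map f xs)) ≡ length (filter (P? ∘ f) xs)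
length-filter-map P? f [] = refl
length-filter-map P? f (x ∷ xs) with P? (f x)
... | yes _ = cong suc (length-filter-map P? f xs)
... | no  _ = length-filter-map P? f xs

sumFrom1-cong : (n : ℕ) {f g : ℕ → ℕ} → (∀ m → 1 ≤ m → m ≤ n → f m ≡ g m) →
                sumFrom1 n f ≡ sumFrom1 n g
sumFrom1-cong zero    f≗g = refl
sumFrom1-cong (suc n) f≗g =
  cong₂ _+_ (sumFrom1-cong n λ m 1≤m m≤n → f≗g m 1≤m (m≤n⇒m≤1+n m≤n))
            (f≗g (suc n) (s≤s z≤n) ≤-refl)

sumFrom1-suc : (n : ℕ) (f : ℕ → ℕ) → sumFrom1 (suc n) f ≡ f 1 + sumFrom1 n (f ∘ suc)
sumFrom1-suc zero    f = +-comm 0 (f 1)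
sumFrom1-suc (suc n) f = trans (cong (_+ f (2 + n)) (sumFrom1-suc n f)) (+-assoc (f 1) _ _)

sumFrom1-+ : (d t : ℕ) (f : ℕ → ℕ) →
             sumFrom1 (d + t) f ≡ sumFrom1 d f + sumFrom1 t (λ m → f (d + m))
sumFrom1-+ d zero    f rewrite +-identityʳ d = sym (+-identityʳ _)
sumFrom1-+ d (suc t) f rewrite +-suc d t =
  trans (cong (_+ f (suc (d + t))) (sumFrom1-+ d t f)) (+-assoc (sumFrom1 d f) _ _)

2*sumFrom1[c*m]≡c*[k+1]*k : (c k : ℕ) → 2 * sumFrom1 k (c *_) ≡ c * (k + 1) * k
2*sumFrom1[c*m]≡c*[k+1]*k c zero    = sym (*-zeroʳ (c * 1))
2*sumFrom1[c*m]≡c*[k+1]*k c (suc k) = begin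
  2 * (sumFrom1 k (c *_) + c * suc k)      ≡⟨ *-distribˡ-+ 2 (sumFrom1 k (c *_)) (c * suc k) ⟩
  2 * sumFrom1 k (c *_) + 2 * (c * suc k)  ≡⟨ cong (_+ 2 * (c * suc k)) (2*sumFrom1[c*m]≡c*[k+1]*k c k) ⟩
  c * (k + 1) * k + 2 * (c * suc k)        ≡⟨ step c k ⟩
  c * (suc k + 1) * suc k                  ∎
  where
  open ≡-Reasoning
  step : ∀ c k → c * (k + 1) * k + 2 * (c * suc k) ≡ c * (suc k + 1) * suc k
  step = solve-∀

2*sumFrom1[t+1∸m]≡[t+1]*t : (t : ℕ) → 2 * sumFrom1 t (λ m → t + 1 ∸ m) ≡ (t + 1) * t
2*sumFrom1[t+1∸m]≡[t+1]*t zero    = refl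
2*sumFrom1[t+1∸m]≡[t+1]*t (suc t) = begin
  2 * sumFrom1 (suc t) (λ m → suc t + 1 ∸ m)      ≡⟨ cong (2 *_) (sumFrom1-suc t (λ m → suc t + 1 ∸ m)) ⟩
  2 * (t + 1 + sumFrom1 t (λ m → t + 1 ∸ m))      ≡⟨ *-distribˡ-+ 2 (t + 1) _ ⟩
  2 * (t + 1) + 2 * sumFrom1 t (λ m → t + 1 ∸ m)  ≡⟨ cong (2 * (t + 1) +_) (2*sumFrom1[t+1∸m]≡[t+1]*t t) ⟩
  2 * (t + 1) + (t + 1) * t                       ≡⟨ step t ⟩
  (suc t + 1) * suc t                             ∎
  where
  open ≡-Reasoning
  step : ∀ t → 2 * (t + 1) + (t + 1) * t ≡ (suc t + 1) * suc t
  step = solve-∀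

2*sumFrom1-min≡p*[d+1]*d+[n∸d+1]*[n∸d] :
  (n p d : ℕ) → d ≤ n →
  (∀ m → m ≤ d → p * m ≤ n + 1 ∸ m) → (∀ m → d < m → n + 1 ∸ m ≤ p * m) →
  2 * sumFrom1 n (λ m → (p * m) ⊓ (n + 1 ∸ m)) ≡ p * (d + 1) * d + (n ∸ d + 1) * (n ∸ d)
2*sumFrom1-min≡p*[d+1]*d+[n∸d+1]*[n∸d] n p d d≤n below above = begin
  2 * sumFrom1 n f                                   ≡⟨ cong (λ k → 2 * sumFrom1 k f) (m+[n∸m]≡n d≤n) ⟨
  2 * sumFrom1 (d + t) f                             ≡⟨ cong (2 *_) (sumFrom1-+ d t f) ⟩
  2 * (sumFrom1 d f + sumFrom1 t (λ m → f (d + m)))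
    ≡⟨ cong (2 *_) (cong₂ _+_ (sumFrom1-cong d λ m _ m≤d → m≤n⇒m⊓n≡m (below m m≤d))
                              (sumFrom1-cong t λ m 1≤m _ → f[d+m]≡t+1∸m m 1≤m)) ⟩
  2 * (sumFrom1 d (p *_) + sumFrom1 t (λ m → t + 1 ∸ m))
    ≡⟨ *-distribˡ-+ 2 (sumFrom1 d (p *_)) _ ⟩
  2 * sumFrom1 d (p *_) + 2 * sumFrom1 t (λ m → t + 1 ∸ m)
    ≡⟨ cong₂ _+_ (2*sumFrom1[c*m]≡c*[k+1]*k p d) (2*sumFrom1[t+1∸m]≡[t+1]*t t) ⟩
  p * (d + 1) * d + (t + 1) * t                      ∎
  where
  open ≡-Reasoning
  f : ℕ → ℕ
  f m = (p * m) ⊓ (n + 1 ∸ m)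
  t = n ∸ d
  f[d+m]≡t+1∸m : ∀ m → 1 ≤ m → f (d + m) ≡ t + 1 ∸ m
  f[d+m]≡t+1∸m m 1≤m = begin
    f (d + m)        ≡⟨ m≥n⇒m⊓n≡n (above (d + m) (m<m+n d 1≤m)) ⟩
    n + 1 ∸ (d + m)  ≡⟨ ∸-+-assoc (n + 1) d m ⟨
    n + 1 ∸ d ∸ m    ≡⟨ cong (_∸ m) (+-∸-comm 1 d≤n) ⟩
    t + 1 ∸ m        ∎

n*m≤o⇔m≤o/n : (n m o : ℕ) .{{_ : NonZero n}} → n * m ≤ o ⇔ m ≤ o / n
n*m≤o⇔m≤o/n n m o = mk⇔
  (λ nm≤o → subst (_≤ o / n) (m*n/n≡m m n) (/-monoˡ-≤ n (subst (_≤ o) (*-comm n m) nm≤o)))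
  (λ m≤o/n → ≤-trans (≤-reflexive (*-comm n m)) (≤-trans (*-monoˡ-≤ n m≤o/n) (m/n*n≤m o n)))

2*[1+n]C2≡[1+n]*n : (n : ℕ) → 2 * (suc n C 2) ≡ suc n * n
2*[1+n]C2≡[1+n]*n zero    = refl
2*[1+n]C2≡[1+n]*n (suc n) = begin
  2 * (suc (suc n) C 2)        ≡⟨ cong (2 *_) (nCk+nC[k+1]≡[n+1]C[k+1] (suc n) 1) ⟨
  2 * (suc n C 1 + suc n C 2)  ≡⟨ cong (λ k → 2 * (k + suc n C 2)) (nC1≡n (suc n)) ⟩
  2 * (suc n + suc n C 2)      ≡⟨ *-distribˡ-+ 2 (suc n) (suc n C 2) ⟩
  2 * suc n + 2 * (suc n C 2)  ≡⟨ cong (2 * suc n +_) (2*[1+n]C2≡[1+n]*n n) ⟩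
  2 * suc n + suc n * n        ≡⟨ step n ⟩
  suc (suc n) * suc n          ∎
  where
  open ≡-Reasoning
  step : ∀ n → 2 * suc n + suc n * n ≡ suc (suc n) * suc n
  step = solve-∀

#subsets : (n : ℕ) {P : Pred (Subset n) 0ℓ} → Decidable P → ℕ
#subsets n P? = length (filter P? (allSubsets n))

#subsets-suc : {P : Pred (Subset (suc n)) 0ℓ} (P? : Decidable P) →
               #subsets (suc n) P? ≡ #subsets n (P? ∘ (inside ∷_)) + #subsets n (P? ∘ (outside ∷_))
#subsets-suc {n} P? = begin
  length (filter P? (ins ++ outs))                  ≡⟨ cong length (filter-++ P? ins outs) ⟩
  length (filter P? ins ++ filter P? outs)          ≡⟨ length-++ (filter P? ins) ⟩
  length (filter P? ins) + length (filter P? outs)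
    ≡⟨ cong₂ _+_ (length-filter-map P? (inside ∷_) S) (length-filter-map P? (outside ∷_) S) ⟩
  #subsets n (P? ∘ (inside ∷_)) + #subsets n (P? ∘ (outside ∷_)) ∎
  where
  open ≡-Reasoning
  S = allSubsets n
  ins = map (inside ∷_) S
  outs = map (outside ∷_) S

#subsets-≐ : {P Q : Pred (Subset n) 0ℓ} (P? : Decidable P) (Q? : Decidable Q) →
             P ≐ Q → #subsets n P? ≡ #subsets n Q?
#subsets-≐ {n} P? Q? P≐Q = cong length (filter-≐ P? Q? P≐Q (allSubsets n))

#subsets-none : {P : Pred (Subset n) 0ℓ} (P? : Decidable P) → (∀ F → ¬ P F) → #subsets n P? ≡ 0
#subsets-none {n} P? ¬P = cong length (filter-none P? (universal ¬P (allSubsets n)))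

nonempty-outside∷⁻ : {F : Subset n} → Nonempty (outside ∷ F) → Nonempty F
nonempty-outside∷⁻ (suc j , there j∈F) = j , j∈F

nonempty-outside∷⁺ : {F : Subset n} → Nonempty F → Nonempty (outside ∷ F)
nonempty-outside∷⁺ (j , j∈F) = suc j , there j∈F

empty? : Decidable (Empty {n})
empty? F = ¬? (nonempty? F)

#subsets-Empty : (n : ℕ) → #subsets n empty? ≡ 1
#subsets-Empty zero    = refl
#subsets-Empty (suc n) = begin
  #subsets (suc n) empty?                         ≡⟨ #subsets-suc (empty? {suc n}) ⟩
  #subsets n (empty? ∘ (inside ∷_)) + #subsets n (empty? ∘ (outside ∷_))
    ≡⟨ cong₂ _+_ (#subsets-none (empty? {suc n} ∘ (inside ∷_)) λ _ e → e (zero , here))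
                 (#subsets-≐ (empty? {suc n} ∘ (outside ∷_)) (empty? {n})
                             (drop-∷-Empty , λ e → e ∘ nonempty-outside∷⁻)) ⟩
  #subsets n empty?                               ≡⟨ #subsets-Empty n ⟩
  1                                               ∎
  where open ≡-Reasoning

IsInitialSegment : Subset n → Set
IsInitialSegment {n} F = (j k : Fin n) → k ∈ F → toℕ j ≤ toℕ k → j ∈ F

isInitialSegment? : Decidable (IsInitialSegment {n})
isInitialSegment? F =
  all? λ j → all? λ k → (k ∈? F) →-dec ((toℕ j ≤? toℕ k) →-dec (j ∈? F))

initialSegment-inside∷⁻ : {F : Subset n} → IsInitialSegment (inside ∷ F) → IsInitialSegment F
initialSegment-inside∷⁻ seg j k k∈F j≤k with seg (suc j) (suc k) (there k∈F) (s≤s j≤k)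
... | there j∈F = j∈F

initialSegment-inside∷⁺ : {F : Subset n} → IsInitialSegment F → IsInitialSegment (inside ∷ F)
initialSegment-inside∷⁺ seg zero    k       _           _         = here
initialSegment-inside∷⁺ seg (suc j) (suc k) (there k∈F) (s≤s j≤k) = there (seg j k k∈F j≤k)

initialSegment-outside∷⁻ : {F : Subset n} → IsInitialSegment (outside ∷ F) → Empty F
initialSegment-outside∷⁻ seg (j , j∈F) with seg zero (suc j) (there j∈F) z≤n
... | ()

initialSegment-outside∷⁺ : {F : Subset n} → Empty F → IsInitialSegment (outside ∷ F)
initialSegment-outside∷⁺ e j (suc k) (there k∈F) _ with () ← e (k , k∈F)

shortInitialSegment? : (c : ℕ) → Decidable (λ (F : Subset n) → IsInitialSegment F × ∣ F ∣ < c)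
shortInitialSegment? c F = isInitialSegment? F ×-dec (∣ F ∣ <? c)

#initialSegments-< : (n c : ℕ) → #subsets n (shortInitialSegment? c) ≡ suc n ⊓ c
#initialSegments-< n       zero    = #subsets-none (shortInitialSegment? {n} 0) λ _ ()
#initialSegments-< zero    (suc c) = refl
#initialSegments-< (suc n) (suc c) = begin
  #subsets (suc n) short                          ≡⟨ #subsets-suc short ⟩
  #subsets n (short ∘ (inside ∷_)) + #subsets n (short ∘ (outside ∷_))
    ≡⟨ cong₂ _+_ (#subsets-≐ (short ∘ (inside ∷_)) (shortInitialSegment? c) inside∷-case)
                 (#subsets-≐ (short ∘ (outside ∷_)) empty? outside∷-case) ⟩
  #subsets n (shortInitialSegment? c) + #subsets n empty?
    ≡⟨ cong₂ _+_ (#initialSegments-< n c) (#subsets-Empty n) ⟩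
  suc n ⊓ c + 1                                   ≡⟨ +-comm (suc n ⊓ c) 1 ⟩
  suc (suc n) ⊓ suc c                             ∎
  where
  open ≡-Reasoning
  short : Decidable (λ (F : Subset (suc n)) → IsInitialSegment F × ∣ F ∣ < suc c)
  short = shortInitialSegment? (suc c)

  inside∷-case : (λ F → IsInitialSegment (inside ∷ F) × ∣ inside ∷ F ∣ < suc c)
                 ≐ (λ F → IsInitialSegment F × ∣ F ∣ < c)
  inside∷-case = (λ (seg , size<) → initialSegment-inside∷⁻ seg , s≤s⁻¹ size<)
               , (λ (seg , size<) → initialSegment-inside∷⁺ seg , s≤s size<)

  ∣F∣≤c : {F : Subset n} → Empty F → ∣ F ∣ ≤ c
  ∣F∣≤c e = subst (_≤ c) (sym (trans (cong ∣_∣ (Empty-unique e)) (∣⊥∣≡0 n))) z≤n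

  outside∷-case : (λ F → IsInitialSegment (outside ∷ F) × ∣ outside ∷ F ∣ < suc c) ≐ Empty
  outside∷-case = (λ (seg , _) → initialSegment-outside∷⁻ seg)
                , (λ e → initialSegment-outside∷⁺ e , s≤s (∣F∣≤c e))

minF-nonempty : {F : Subset n} → Nonempty F → ∃ λ m → minF F ≡ suc m
minF-nonempty {F = inside ∷ F}  _                   = 0 , refl
minF-nonempty {F = outside ∷ F} (suc j , there j∈F) with minF F | minF-nonempty (j , j∈F)
... | suc m | _ = suc m , refl

minF-outside∷ : {F : Subset n} → Nonempty F → minF (outside ∷ F) ≡ suc (minF F)
minF-outside∷ ne with minF-nonempty ne
... | m , minF≡1+m rewrite minF≡1+m = refl

isInterval-inside∷⁻ : {F : Subset n} → IsInterval (inside ∷ F) → IsInitialSegment F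
isInterval-inside∷⁻ iv j k k∈F j≤k with iv zero (suc j) (suc k) here (there k∈F) z≤n (s≤s j≤k)
... | there j∈F = j∈F

isInterval-inside∷⁺ : {F : Subset n} → IsInitialSegment F → IsInterval (inside ∷ F)
isInterval-inside∷⁺ seg _ j k _ k∈ _ j≤k = initialSegment-inside∷⁺ seg j k k∈ j≤k

isInterval-outside∷⁻ : {F : Subset n} → IsInterval (outside ∷ F) → IsInterval F
isInterval-outside∷⁻ iv i j k i∈F k∈F i≤j j≤k
  with iv (suc i) (suc j) (suc k) (there i∈F) (there k∈F) (s≤s i≤j) (s≤s j≤k)
... | there j∈F = j∈F

isInterval-outside∷⁺ : {F : Subset n} → IsInterval F → IsInterval (outside ∷ F)
isInterval-outside∷⁺ iv (suc i) (suc j) (suc k) (there i∈F) (there k∈F) (s≤s i≤j) (s≤s j≤k) =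
  there (iv i j k i∈F k∈F i≤j j≤k)

-- F ⊆ [n] stands for its translate s + F ⊆ {s+1, …, s+n}; Sr n p is ShiftedSr n p 0.
ShiftedSrCond : (n p s : ℕ) → Subset n → Set
ShiftedSrCond n p s F = Nonempty F × ∣ F ∣ ≤ p * (s + minF F) × IsInterval F

shiftedSrCond? : (n p s : ℕ) → Decidable (ShiftedSrCond n p s)
shiftedSrCond? n p s F = nonempty? F ×-dec ((∣ F ∣ ≤? p * (s + minF F)) ×-dec isInterval? F)

ShiftedSr : (n p s : ℕ) → ℕ
ShiftedSr n p s = #subsets n (shiftedSrCond? n p s)

ShiftedSr-suc : (n p s : ℕ) → ShiftedSr (suc n) p s ≡ suc n ⊓ (p * (s + 1)) + ShiftedSr n p (suc s)
ShiftedSr-suc n p s = begin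
  ShiftedSr (suc n) p s                                              ≡⟨ #subsets-suc cond ⟩
  #subsets n (cond ∘ (inside ∷_)) + #subsets n (cond ∘ (outside ∷_))
    ≡⟨ cong₂ _+_ (#subsets-≐ (cond ∘ (inside ∷_)) (shortInitialSegment? (p * (s + 1))) inside∷-case)
                 (#subsets-≐ (cond ∘ (outside ∷_)) (shiftedSrCond? n p (suc s)) outside∷-case) ⟩
  #subsets n (shortInitialSegment? (p * (s + 1))) + ShiftedSr n p (suc s)
    ≡⟨ cong (_+ ShiftedSr n p (suc s)) (#initialSegments-< n (p * (s + 1))) ⟩
  suc n ⊓ (p * (s + 1)) + ShiftedSr n p (suc s)                      ∎
  where
  open ≡-Reasoning
  cond = shiftedSrCond? (suc n) p s

  inside∷-case : ShiftedSrCond (suc n) p s ∘ (inside ∷_)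
                 ≐ (λ F → IsInitialSegment F × ∣ F ∣ < p * (s + 1))
  inside∷-case = (λ (_ , size≤ , iv) → isInterval-inside∷⁻ iv , size≤)
               , (λ (seg , size<) → (zero , here) , size< , isInterval-inside∷⁺ seg)

  p*shift : {F : Subset n} → Nonempty F → p * (s + minF (outside ∷ F)) ≡ p * (suc s + minF F)
  p*shift ne = cong (p *_) (trans (cong (s +_) (minF-outside∷ ne)) (+-suc s _))

  outside∷-case : ShiftedSrCond (suc n) p s ∘ (outside ∷_) ≐ ShiftedSrCond n p (suc s)
  outside∷-case =
      (λ (ne , size≤ , iv) → let ne′ = nonempty-outside∷⁻ ne in
         ne′ , ≤-trans size≤ (≤-reflexive (p*shift ne′)) , isInterval-outside∷⁻ iv)
    , (λ (ne , size≤ , iv) →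
         nonempty-outside∷⁺ ne , ≤-trans size≤ (≤-reflexive (sym (p*shift ne))) , isInterval-outside∷⁺ iv)

ShiftedSr≡sumFrom1 : (n p s : ℕ) → ShiftedSr n p s ≡ sumFrom1 n (λ m → (p * (s + m)) ⊓ (n + 1 ∸ m))
ShiftedSr≡sumFrom1 zero    p s = refl
ShiftedSr≡sumFrom1 (suc n) p s = begin
  ShiftedSr (suc n) p s
    ≡⟨ ShiftedSr-suc n p s ⟩
  suc n ⊓ (p * (s + 1)) + ShiftedSr n p (suc s)
    ≡⟨ cong₂ _+_ (trans (⊓-comm (suc n) _) (cong (p * (s + 1) ⊓_) (+-comm 1 n)))
                 (ShiftedSr≡sumFrom1 n p (suc s)) ⟩
  (p * (s + 1)) ⊓ (n + 1) + sumFrom1 n (λ m → (p * (suc s + m)) ⊓ (n + 1 ∸ m))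
    ≡⟨ cong ((p * (s + 1)) ⊓ (n + 1) +_)
            (sumFrom1-cong n λ m _ _ → cong (λ k → (p * k) ⊓ (n + 1 ∸ m)) (sym (+-suc s m))) ⟩
  (p * (s + 1)) ⊓ (n + 1) + sumFrom1 n (λ m → (p * (s + suc m)) ⊓ (n + 1 ∸ m))
    ≡⟨ sumFrom1-suc n (λ m → (p * (s + m)) ⊓ (suc n + 1 ∸ m)) ⟨
  sumFrom1 (suc n) (λ m → (p * (s + m)) ⊓ (suc n + 1 ∸ m))
    ∎
  where open ≡-Reasoning

Sr≡sumFrom1 : (n p : ℕ) → Sr n p ≡ sumFrom1 n (λ m → (p * m) ⊓ (n + 1 ∸ m))
Sr≡sumFrom1 n p = ShiftedSr≡sumFrom1 n p 0

module Threshold (n p : ℕ) where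

  Δ : ℕ
  Δ = (n + 1) / suc p

  m≤Δ⇒p*m≤n+1∸m : ∀ m → m ≤ Δ → p * m ≤ n + 1 ∸ m
  m≤Δ⇒p*m≤n+1∸m m m≤Δ = m+n≤o⇒m≤o∸n (p * m) (subst (_≤ n + 1) (+-comm m (p * m))
    (Equivalence.from (n*m≤o⇔m≤o/n (suc p) m (n + 1)) m≤Δ))

  Δ<m⇒n+1∸m≤p*m : ∀ m → Δ < m → n + 1 ∸ m ≤ p * m
  Δ<m⇒n+1∸m≤p*m m Δ<m = m≤n+o⇒m∸n≤o (n + 1) m (<⇒≤ (≰⇒> λ [1+p]*m≤n+1 →
    <⇒≱ Δ<m (Equivalence.to (n*m≤o⇔m≤o/n (suc p) m (n + 1)) [1+p]*m≤n+1)))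

  Δ≤n : 1 ≤ p → Δ ≤ n
  Δ≤n 1≤p = m<1+n⇒m≤n
    (subst (λ k → k / suc p < suc n) (+-comm 1 n) (m/n<m (suc n) (suc p) (s≤s 1≤p)))

  2*Sr≡p*[Δ+1]*Δ+[n∸Δ+1]*[n∸Δ] : 1 ≤ p → 2 * Sr n p ≡ p * (Δ + 1) * Δ + (n ∸ Δ + 1) * (n ∸ Δ)
  2*Sr≡p*[Δ+1]*Δ+[n∸Δ+1]*[n∸Δ] 1≤p = trans (cong (2 *_) (Sr≡sumFrom1 n p))
    (2*sumFrom1-min≡p*[d+1]*d+[n∸d+1]*[n∸d] n p Δ (Δ≤n 1≤p) m≤Δ⇒p*m≤n+1∸m Δ<m⇒n+1∸m≤p*m)

Sr≡[n+1]C2 : (n p : ℕ) → n < p → Sr n p ≡ (n + 1) C 2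
Sr≡[n+1]C2 n p n<p = *-cancelˡ-≡ (Sr n p) ((n + 1) C 2) 2 (begin
  2 * Sr n p                               ≡⟨ 2*Sr≡p*[Δ+1]*Δ+[n∸Δ+1]*[n∸Δ] (≤-trans (s≤s z≤n) n<p) ⟩
  p * (Δ + 1) * Δ + (n ∸ Δ + 1) * (n ∸ Δ)  ≡⟨ cong (λ d → p * (d + 1) * d + (n ∸ d + 1) * (n ∸ d)) Δ≡0 ⟩
  p * 1 * 0 + (n + 1) * n                  ≡⟨ cong (_+ (n + 1) * n) (*-zeroʳ (p * 1)) ⟩
  (n + 1) * n                              ≡⟨ 2*[n+1]C2≡[n+1]*n ⟨
  2 * ((n + 1) C 2)                        ∎)
  where
  open ≡-Reasoning
  open Threshold n p
  Δ≡0 : Δ ≡ 0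
  Δ≡0 = m<n⇒m/n≡0 (s≤s (subst (_≤ p) (+-comm 1 n) n<p))
  2*[n+1]C2≡[n+1]*n : 2 * ((n + 1) C 2) ≡ (n + 1) * n
  2*[n+1]C2≡[n+1]*n = subst (λ k → 2 * (k C 2) ≡ k * n) (+-comm 1 n) (2*[1+n]C2≡[1+n]*n n)

Sr1p≡1 : (p : ℕ) → 1 ≤ p → Sr 1 p ≡ 1
Sr1p≡1 (suc p) _ = refl

lemma3p2 : (n p : ℕ) → 1 ≤ n → 1 ≤ p →
    (Sr n p ≡ sumFrom1 n (λ m → (p * m) ⊓ (n + 1 ∸ m)))
    × (n ≡ 1 → Sr n p ≡ 1)
    × (2 ≤ n → n < p → Sr n p ≡ (n + 1) C 2)
    × (p ≤ n → 2 * Sr n p ≡ p * (((n + 1) / (suc p)) + 1) * ((n + 1) / (suc p))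
                             + (n ∸ (n + 1) / (suc p) + 1) * (n ∸ (n + 1) / (suc p)))
lemma3p2 n p _ 1≤p =
    Sr≡sumFrom1 n p
  , (λ { refl → Sr1p≡1 p 1≤p })
  , (λ _ → Sr≡[n+1]C2 n p)
  , (λ _ → Threshold.2*Sr≡p*[Δ+1]*Δ+[n∸Δ+1]*[n∸Δ] n p 1≤p)
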